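{- Consider the instance $X$ described in the context, and let $C$ be an optimal solution of the discrete k-means problem on $X$ with $k$ centers. Let $L$ be the set of locations (points of $\mathbb{R}^2$) of the centers in $C$. Then $(0,0) \in L$.
   Context: Fix an integer $k \ge 2$, a positive integer $m$ such that all multiplicities below are integers (e.g. $4^{2k}$ divides $m$), a real $r > 0$ and a real $\Delta \ge 1$. For $1 \le i \le k-1$ let $r_i = 2^{i-1} r$ and $m_i = m/4^{i-1}$; let $x_0 = 0$ and $x_i = \Delta (r_1 + \dots + r_i)$. The instance $X$ is the multiset of points in $\mathbb{R}^2$ consisting of groups $G_0, \dots, G_{k-1}$: $G_0$ consists of $12 k 2^k m$ copies of $(0,0)$; for $1 \le i \le k-1$, $G_i$ consists of $4 k m_i$ copies of $(x_i, 0)$ and, for each $0 \le j \le k-1$, $m_i/4^j$ copies of $(x_i, 2^j r_i)$ and $m_i/4^j$ copies of $(x_i, -2^j r_i)$. The discrete k-means problem on $X$: choose a set $C$ of $k$ centers among the points of $X$ minimizing $\Phi_C(X) = \sum_{x \in X} \min_{c \in C} D(x,c)$, with $D$ the squared Euclidean distance. -}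

module Defs where

open import Level using (Level; _⊔_)
open import Data.Nat as ℕ using (ℕ; zero; suc)
open import Data.Nat.Properties using (m^n≢0)
open import Data.Nat.DivMod using (_/_)
open import Data.Fin using (Fin; zero; suc)
open import Data.List using (List; []; _∷_; _++_; replicate; concatMap; upTo; map; foldr; length; lookup)
open import Data.Product using (_×_; _,_; proj₁; proj₂; ∃)
open import Data.Sum using ([_,_]′)
open import Relation.Nullary using (¬_)
open import Relation.Binary.Structures using (IsTotalOrder)
open import Algebra.Bundles using (CommutativeRing)

-- Ordered fields.  The agda-stdlib has no real numbers, so the statement
-- is made for an arbitrary ordered field F (ℝ being one instance).

record OrderedField (c ℓ₁ ℓ₂ : Level) : Set (Level.suc (c ⊔ ℓ₁ ⊔ ℓ₂)) where
  field
    commutativeRing : CommutativeRing c ℓ₁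
  open CommutativeRing commutativeRing public
    using (Carrier; _≈_; _+_; _*_; -_; _-_; 0#; 1#; setoid; ring)
  field
    _≤_          : Carrier → Carrier → Set ℓ₂
    isTotalOrder : IsTotalOrder _≈_ _≤_
    +-monoˡ-≤    : ∀ {a b} z → a ≤ b → (a + z) ≤ (b + z)
    *-nonneg     : ∀ {a b} → 0# ≤ a → 0# ≤ b → 0# ≤ (a * b)
    0≉1          : ¬ (0# ≈ 1#)
    inverse      : ∀ a → ¬ (a ≈ 0#) → ∃ λ b → (a * b) ≈ 1#

  _<_ : Carrier → Carrier → Set (ℓ₁ ⊔ ℓ₂)
  a < b = (a ≤ b) × ¬ (a ≈ b)

  open IsTotalOrder isTotalOrder public using (total)

  min : Carrier → Carrier → Carrier
  min a b = [ (λ _ → a) , (λ _ → b) ]′ (total a b)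

  -- minimum over a finite family indexed by Fin n
  -- (value 0# for the empty family; never used, since k ≥ 2)
  minFin : ∀ n → (Fin n → Carrier) → Carrier
  minFin zero          f = 0#
  minFin (suc zero)    f = f zero
  minFin (suc (suc n)) f = min (f zero) (minFin (suc n) (λ i → f (suc i)))

  sumL : List Carrier → Carrier
  sumL = foldr _+_ 0#

  ι : ℕ → Carrier
  ι zero    = 0#
  ι (suc n) = 1# + ι n

  Point : Set c
  Point = Carrier × Carrier

  sq : Carrier → Carrier
  sq a = a * a

  D : Point → Point → Carrier
  D (a , b) (a' , b') = sq (a - a') + sq (b - b')

  Φ : ∀ k → (Fin k → Point) → List Point → Carrier
  Φ k cs X = sumL (map (λ x → minFin k (λ i → D x (cs i))) X)

  _/4^_ : ℕ → ℕ → ℕ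
  n /4^ e = _/_ n (4 ℕ.^ e) {{m^n≢0 4 e}}

  rᵢ : Carrier → ℕ → Carrier
  rᵢ r i = ι (2 ℕ.^ (i ℕ.∸ 1)) * r

  xᵢ : Carrier → Carrier → ℕ → Carrier
  xᵢ r Δ i = Δ * sumL (map (λ l → rᵢ r (suc l)) (upTo i))

  mᵢ : ℕ → ℕ → ℕ
  mᵢ m i = m /4^ (i ℕ.∸ 1)

  G₀ : ℕ → ℕ → List Point
  G₀ k m = replicate (12 ℕ.* k ℕ.* (2 ℕ.^ k) ℕ.* m) (0# , 0#)

  Gᵢ : ℕ → ℕ → Carrier → Carrier → ℕ → List Point
  Gᵢ k m r Δ i =
    replicate (4 ℕ.* k ℕ.* mᵢ m i) (xᵢ r Δ i , 0#)
    ++ concatMap (λ j →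
            replicate (mᵢ m i /4^ j) (xᵢ r Δ i , ι (2 ℕ.^ j) * rᵢ r i)
         ++ replicate (mᵢ m i /4^ j) (xᵢ r Δ i , - (ι (2 ℕ.^ j) * rᵢ r i)))
       (upTo k)

  instanceX : ℕ → ℕ → Carrier → Carrier → List Point
  instanceX k m r Δ = G₀ k m ++ concatMap (λ l → Gᵢ k m r Δ (suc l)) (upTo (k ℕ.∸ 1))

module Submission where

-- If no optimal center lies at the origin, every center lies in some group Gᵢ, whose points all have
-- abscissa xᵢ ≥ r; then each of the N₀ = 12 k 2ᵏ m copies of the origin costs at least r², so the cost
-- is at least N₀ r². The competitor {(0,0), (x₁,0), …, (x_{k-1},0)} pays nothing on G₀ and, on Gᵢ, only
-- vertical offsets: the mᵢ/4ʲ points at each height ±2ʲ rᵢ cost mᵢ/4ʲ · 4ʲ rᵢ² = m r² per sign, hence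
-- at most 2 k m r² per group and (k-1) · 2 k m r² < N₀ r² in total, contradicting optimality.

open import Defs
open import Level using (Level)
open import Data.Nat as ℕ using (ℕ; zero; suc; _∸_; _^_; NonZero; s≤s; z≤n)
import Data.Nat.Properties as ℕ
import Data.Nat.DivMod as ℕ
open import Data.Nat.Divisibility using (_∣_; ∣⇒≤)
open import Data.Nat.Tactic.RingSolver using (solve-∀)
open import Data.Fin as Fin using (Fin; toℕ)
import Data.Fin.Properties as Fin
open import Data.List using (List; []; _∷_; _++_; replicate; concatMap; upTo; map; length; lookup)
import Data.List.Properties as List
import Data.List.Relation.Unary.Any as Any
import Data.List.Relation.Unary.Any.Properties as Any
open import Data.List.Relation.Unary.All as All using (All)
import Data.List.Relation.Unary.All.Properties as All
open import Data.List.Membership.Propositional using (_∈_)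
open import Data.List.Membership.Propositional.Properties
  using (∈-++⁺ˡ; ∈-++⁺ʳ; ∈-++⁻; ∈-concatMap⁺; ∈-upTo⁺; ∈-lookup)
open import Data.Product using (_×_; _,_; ∃; proj₁; proj₂)
open import Data.Sum using (_⊎_; inj₁; inj₂)
open import Data.Empty using (⊥-elim)
open import Function.Definitions using (Injective)
open import Relation.Nullary using (¬_)
open import Relation.Binary.Definitions using (tri<; tri≈; tri>)
open import Relation.Binary.PropositionalEquality as ≡ using (_≡_)
open import Relation.Binary.Structures using (IsTotalOrder)
open import Relation.Binary.Bundles using (Setoid)
import Relation.Binary.Reasoning.Setoid as ≈-Reasoning
open import Algebra.Bundles using (CommutativeRing)
import Algebra.Properties.Ring as RingProperties
import Algebra.Solver.Ring.NaturalCoefficients.Default as RingSolver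

n<2^n : ∀ n → n ℕ.< 2 ^ n
n<2^n zero    = s≤s z≤n
n<2^n (suc n) = ℕ.+-mono-≤ (ℕ.m^n>0 2 n) (ℕ.≤-trans (n<2^n n) (ℕ.m≤m+n (2 ^ n) 0))

4^n≡2^n*2^n : ∀ n → 4 ^ n ≡ 2 ^ n ℕ.* 2 ^ n
4^n≡2^n*2^n zero    = ≡.refl
4^n≡2^n*2^n (suc n) = ≡.trans (≡.cong (4 ℕ.*_) (4^n≡2^n*2^n n)) (4*[x*x]≡[2*x]*[2*x] (2 ^ n))
  where
  4*[x*x]≡[2*x]*[2*x] : ∀ x → 4 ℕ.* (x ℕ.* x) ≡ (2 ℕ.* x) ℕ.* (2 ℕ.* x)
  4*[x*x]≡[2*x]*[2*x] = solve-∀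

[2^a*2^b]²≡4^b*4^a : ∀ a b → (2 ^ a ℕ.* 2 ^ b) ℕ.* (2 ^ a ℕ.* 2 ^ b) ≡ 4 ^ b ℕ.* 4 ^ a
[2^a*2^b]²≡4^b*4^a a b =
  ≡.trans ([x*y]²≡y²*x² (2 ^ a) (2 ^ b)) (≡.sym (≡.cong₂ ℕ._*_ (4^n≡2^n*2^n b) (4^n≡2^n*2^n a)))
  where
  [x*y]²≡y²*x² : ∀ x y → (x ℕ.* y) ℕ.* (x ℕ.* y) ≡ (y ℕ.* y) ℕ.* (x ℕ.* x)
  [x*y]²≡y²*x² = solve-∀

m/a/b*[a*b]≡m : ∀ m a b .{{_ : NonZero a}} .{{_ : NonZero b}} → a ℕ.* b ∣ m → m ℕ./ a ℕ./ b ℕ.* (a ℕ.* b) ≡ m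
m/a/b*[a*b]≡m m a b a*b∣m = ≡.trans (≡.cong (ℕ._* (a ℕ.* b)) (ℕ.m/n/o≡m/[n*o] m a b)) (ℕ.m/n*n≡m a*b∣m)
  where instance _ = ℕ.m*n≢0 a b

n*[k*[m+m]]<12*k*2^k*m : ∀ n m .{{_ : NonZero m}} →
  n ℕ.* (suc n ℕ.* (m ℕ.+ m)) ℕ.< 12 ℕ.* suc n ℕ.* 2 ^ suc n ℕ.* m
n*[k*[m+m]]<12*k*2^k*m n m@(suc _) = ℕ.<-≤-trans
  (ℕ.*-monoˡ-< (suc n ℕ.* (m ℕ.+ m)) (ℕ.<-≤-trans (n<2^n n) (ℕ.m≤m+n (2 ^ n) _)))
  (ℕ.≤-trans (ℕ.m≤m*n _ 6) (ℕ.≤-reflexive (p*[k*[m+m]]*6≡12*k*p*m (2 ^ suc n) (suc n) m)))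
  where
  p*[k*[m+m]]*6≡12*k*p*m : ∀ p k m → p ℕ.* (k ℕ.* (m ℕ.+ m)) ℕ.* 6 ≡ 12 ℕ.* k ℕ.* p ℕ.* m
  p*[k*[m+m]]*6≡12*k*p*m = solve-∀

∃-⊎-∀ : ∀ {p q n} {P : Fin n → Set p} {Q : Fin n → Set q} → (∀ t → P t ⊎ Q t) → ∃ P ⊎ (∀ t → Q t)
∃-⊎-∀ {n = zero}  P⊎Q = inj₂ λ ()
∃-⊎-∀ {n = suc n} P⊎Q with P⊎Q Fin.zero | ∃-⊎-∀ (λ t → P⊎Q (Fin.suc t))
... | inj₁ P0 | _             = inj₁ (Fin.zero , P0)
... | inj₂ _  | inj₁ (t , Pt) = inj₁ (Fin.suc t , Pt)
... | inj₂ Q0 | inj₂ Q        = inj₂ λ { Fin.zero → Q0 ; (Fin.suc t) → Q t }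

∈-replicate⁺ : ∀ {a} {A : Set a} n .{{_ : NonZero n}} {x : A} → x ∈ replicate n x
∈-replicate⁺ (suc n) = Any.here ≡.refl

module _ {a n} {A : Set a} {xs : List A} {p : Fin n → A} (p∈xs : ∀ t → p t ∈ xs) where

  indices : Fin n → Fin (length xs)
  indices t = Any.index (p∈xs t)

  lookup-indices : ∀ t → lookup xs (indices t) ≡ p t
  lookup-indices t = ≡.sym (Any.lookup-index (p∈xs t))

  indices-injective : Injective _≡_ _≡_ p → Injective _≡_ _≡_ indices
  indices-injective p-injective {s} {t} eq =
    p-injective (≡.trans (≡.sym (lookup-indices s)) (≡.trans (≡.cong (lookup xs) eq) (lookup-indices t)))

module OrderedFieldProperties {c ℓ₁ ℓ₂ : Level} (F : OrderedField c ℓ₁ ℓ₂) where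
  -- Defs declares no fixity for the order relations.
  open OrderedField F renaming (_≤_ to infix 4 _≤_; _<_ to infix 4 _<_)
  open CommutativeRing commutativeRing
    using ( refl; sym; trans; reflexive; +-cong; +-congˡ; +-congʳ; *-cong; *-congˡ; *-congʳ; -‿cong
          ; +-identityˡ; +-identityʳ; *-identityˡ; zeroˡ; zeroʳ; +-comm; *-comm; +-assoc; *-assoc
          ; distribʳ; -‿inverseˡ; -‿inverseʳ)
  open IsTotalOrder isTotalOrder public
    using (antisym)
    renaming ( refl to ≤-refl; reflexive to ≤-reflexive; trans to ≤-trans
             ; ≤-respˡ-≈ to ≤-respˡ; ≤-respʳ-≈ to ≤-respʳ)
  open RingProperties ring using (-0#≈0#; -‿distribˡ-*; -‿distribʳ-*; -‿involutive; [y-z]x≈yx-zx)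

  +-mono-≤ : ∀ {a b c d} → a ≤ b → c ≤ d → a + c ≤ b + d
  +-mono-≤ {a} {b} {c} {d} a≤b c≤d =
    ≤-trans (+-monoˡ-≤ c a≤b) (≤-respˡ (+-comm c b) (≤-respʳ (+-comm d b) (+-monoˡ-≤ b c≤d)))

  x≤y⇒0≤y-x : ∀ {a b} → a ≤ b → 0# ≤ b - a
  x≤y⇒0≤y-x {a} a≤b = ≤-respˡ (-‿inverseʳ a) (+-monoˡ-≤ (- a) a≤b)

  y-x+x≈y : ∀ x y → (y - x) + x ≈ y
  y-x+x≈y x y = trans (+-assoc y (- x) x) (trans (+-congˡ (-‿inverseˡ x)) (+-identityʳ y))

  0≤y-x⇒x≤y : ∀ {a b} → 0# ≤ b - a → a ≤ b
  0≤y-x⇒x≤y {a} {b} 0≤b-a = ≤-respˡ (+-identityˡ a) (≤-respʳ (y-x+x≈y a b) (+-monoˡ-≤ a 0≤b-a))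

  sq-neg : ∀ a → sq (- a) ≈ sq a
  sq-neg a =
    trans (sym (-‿distribˡ-* a (- a))) (trans (-‿cong (sym (-‿distribʳ-* a a))) (-‿involutive (a * a)))

  0≤sq : ∀ a → 0# ≤ sq a
  0≤sq a with total 0# a
  ... | inj₁ 0≤a = *-nonneg 0≤a 0≤a
  ... | inj₂ a≤0 = ≤-respʳ (sq-neg a) (*-nonneg 0≤-a 0≤-a)
    where
    0≤-a : 0# ≤ - a
    0≤-a = ≤-respʳ (+-identityˡ (- a)) (x≤y⇒0≤y-x a≤0)

  0≤1 : 0# ≤ 1#
  0≤1 = ≤-respʳ (*-identityˡ 1#) (0≤sq 1#)

  0<1 : 0# < 1#
  0<1 = 0≤1 , 0≉1

  *-monoˡ-≤-nonneg : ∀ {a b} c → 0# ≤ c → a ≤ b → a * c ≤ b * c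
  *-monoˡ-≤-nonneg {a} {b} c 0≤c a≤b =
    0≤y-x⇒x≤y (≤-respʳ ([y-z]x≈yx-zx c b a) (*-nonneg (x≤y⇒0≤y-x a≤b) 0≤c))

  sq-mono-≤ : ∀ {a b} → 0# ≤ a → a ≤ b → sq a ≤ sq b
  sq-mono-≤ {a} {b} 0≤a a≤b =
    ≤-trans (*-monoˡ-≤-nonneg a 0≤a a≤b)
            (≤-respˡ (*-comm a b) (≤-respʳ (*-comm b b) (*-monoˡ-≤-nonneg b (≤-trans 0≤a a≤b) a≤b)))

  1≤y⇒x≤y*x : ∀ {a b} → 1# ≤ b → 0# ≤ a → a ≤ b * a
  1≤y⇒x≤y*x {a} 1≤b 0≤a = ≤-respˡ (*-identityˡ a) (*-monoˡ-≤-nonneg a 0≤a 1≤b)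

  <-≤-trans : ∀ {a b d} → a < b → b ≤ d → a < d
  <-≤-trans (a≤b , a≉b) b≤d = ≤-trans a≤b b≤d , λ a≈d → a≉b (antisym a≤b (≤-respʳ (sym a≈d) b≤d))

  ≤-<-trans : ∀ {a b d} → a ≤ b → b < d → a < d
  ≤-<-trans a≤b (b≤d , b≉d) = ≤-trans a≤b b≤d , λ a≈d → b≉d (antisym b≤d (≤-respˡ a≈d a≤b))

  <-trans : ∀ {a b d} → a < b → b < d → a < d
  <-trans a<b (b≤d , _) = <-≤-trans a<b b≤d

  <-irrefl : ∀ {a} → ¬ (a < a)
  <-irrefl (_ , a≉a) = a≉a refl

  <-respˡ : ∀ {a b d} → a ≈ b → a < d → b < d
  <-respˡ a≈b (a≤d , a≉d) = ≤-respˡ a≈b a≤d , λ b≈d → a≉d (trans a≈b b≈d)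

  <-respʳ : ∀ {a b d} → b ≈ d → a < b → a < d
  <-respʳ b≈d (a≤b , a≉b) = ≤-respʳ b≈d a≤b , λ a≈d → a≉b (trans a≈d (sym b≈d))

  x<x+y : ∀ {a b} → 0# < b → a < a + b
  x<x+y {a} {b} (0≤b , 0≉b) =
    ≤-respˡ (+-identityˡ a) (≤-respʳ (+-comm b a) (+-monoˡ-≤ a 0≤b)) , λ a≈a+b →
      0≉b (trans (sym (-‿inverseˡ a)) (trans (+-congˡ a≈a+b)
        (trans (sym (+-assoc (- a) a b)) (trans (+-congʳ (-‿inverseˡ a)) (+-identityˡ b)))))

  pos*pos⇒pos : ∀ {a b} → 0# < a → 0# < b → 0# < a * b
  pos*pos⇒pos {a} {b} (0≤a , 0≉a) (0≤b , 0≉b) = *-nonneg 0≤a 0≤b , λ 0≈ab →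
    let a⁻¹ , aa⁻¹≈1 = inverse a (λ a≈0 → 0≉a (sym a≈0)) in
    0≉b (sym (trans (sym (*-identityˡ b)) (trans (*-congʳ (sym (trans (*-comm a⁻¹ a) aa⁻¹≈1)))
      (trans (*-assoc a⁻¹ a b) (trans (*-congˡ (sym 0≈ab)) (zeroʳ a⁻¹))))))

  ι-+ : ∀ a b → ι (a ℕ.+ b) ≈ ι a + ι b
  ι-+ zero    b = sym (+-identityˡ (ι b))
  ι-+ (suc a) b = trans (+-congˡ (ι-+ a b)) (sym (+-assoc 1# (ι a) (ι b)))

  ι-* : ∀ a b → ι (a ℕ.* b) ≈ ι a * ι b
  ι-* zero    b = sym (zeroˡ (ι b))
  ι-* (suc a) b = trans (ι-+ b (a ℕ.* b))
    (trans (+-cong (sym (*-identityˡ (ι b))) (ι-* a b)) (sym (distribʳ (ι b) 1# (ι a))))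

  0≤ι : ∀ n → 0# ≤ ι n
  0≤ι zero    = ≤-refl
  0≤ι (suc n) = ≤-respˡ (+-identityˡ 0#) (+-mono-≤ 0≤1 (0≤ι n))

  ι<ι-suc : ∀ n → ι n < ι (suc n)
  ι<ι-suc n = <-respʳ (+-comm (ι n) 1#) (x<x+y 0<1)

  module StrictlyIncreasing (u : ℕ → Carrier) (u<u-suc : ∀ n → u n < u (suc n)) where

    strictMono : ∀ {a b} → a ℕ.< b → u a < u b
    strictMono {a} {suc b} a<1+b with ℕ.m<1+n⇒m<n∨m≡n a<1+b
    ... | inj₁ a<b     = <-trans (strictMono a<b) (u<u-suc b)
    ... | inj₂ ≡.refl = u<u-suc a

    mono : ∀ {a b} → a ℕ.≤ b → u a ≤ u b
    mono a≤b with ℕ.m≤n⇒m<n∨m≡n a≤b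
    ... | inj₁ a<b     = proj₁ (strictMono a<b)
    ... | inj₂ ≡.refl = ≤-refl

    ≈-injective : ∀ {a b} → u a ≈ u b → a ≡ b
    ≈-injective {a} {b} ua≈ub with ℕ.<-cmp a b
    ... | tri< a<b _ _ = ⊥-elim (proj₂ (strictMono a<b) ua≈ub)
    ... | tri≈ _ a≡b _ = a≡b
    ... | tri> _ _ b<a = ⊥-elim (proj₂ (strictMono b<a) (sym ua≈ub))

  0<ι : ∀ {n} → 0 ℕ.< n → 0# < ι n
  0<ι = StrictlyIncreasing.strictMono ι ι<ι-suc

  ι-*-monoˡ-< : ∀ {a b d} → a ℕ.< b → 0# < d → ι a * d < ι b * d
  ι-*-monoˡ-< {a} {b} {d} a<b 0<d =
    <-respʳ ι[a]*d+ι[b∸a]*d≈ι[b]*d (x<x+y (pos*pos⇒pos (0<ι (ℕ.m<n⇒0<n∸m a<b)) 0<d))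
    where
    ι[a]*d+ι[b∸a]*d≈ι[b]*d : ι a * d + ι (b ∸ a) * d ≈ ι b * d
    ι[a]*d+ι[b∸a]*d≈ι[b]*d = trans (sym (distribʳ d (ι a) (ι (b ∸ a))))
      (*-congʳ (trans (sym (ι-+ a (b ∸ a))) (reflexive (≡.cong ι (ℕ.m+[n∸m]≡n (ℕ.<⇒≤ a<b))))))

  module _ {a} {A : Set a} (f : A → Carrier) where

    sumL-map-++ : ∀ xs ys → sumL (map f (xs ++ ys)) ≈ sumL (map f xs) + sumL (map f ys)
    sumL-map-++ []       ys = sym (+-identityˡ _)
    sumL-map-++ (x ∷ xs) ys = trans (+-congˡ (sumL-map-++ xs ys)) (sym (+-assoc _ _ _))

    sumL-map-replicate : ∀ n x → sumL (map f (replicate n x)) ≈ ι n * f x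
    sumL-map-replicate zero    x = sym (zeroˡ (f x))
    sumL-map-replicate (suc n) x =
      trans (+-cong (sym (*-identityˡ (f x))) (sumL-map-replicate n x)) (sym (distribʳ (f x) 1# (ι n)))

    0≤sumL-map : (∀ x → 0# ≤ f x) → ∀ xs → 0# ≤ sumL (map f xs)
    0≤sumL-map 0≤f []       = ≤-refl
    0≤sumL-map 0≤f (x ∷ xs) = ≤-respˡ (+-identityˡ 0#) (+-mono-≤ (0≤f x) (0≤sumL-map 0≤f xs))

    sumL-map-mono : ∀ {g : A → Carrier} → (∀ x → f x ≤ g x) → ∀ xs → sumL (map f xs) ≤ sumL (map g xs)
    sumL-map-mono f≤g []       = ≤-refl
    sumL-map-mono f≤g (x ∷ xs) = +-mono-≤ (f≤g x) (sumL-map-mono f≤g xs)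

    sumL-map-concatMap : ∀ {b} {B : Set b} (g : B → List A) ys →
      sumL (map f (concatMap g ys)) ≈ sumL (map (λ y → sumL (map f (g y))) ys)
    sumL-map-concatMap g []       = refl
    sumL-map-concatMap g (y ∷ ys) =
      trans (sumL-map-++ (g y) (concatMap g ys)) (+-congˡ (sumL-map-concatMap g ys))

  sumL-map-upTo-suc : ∀ (h : ℕ → Carrier) n → sumL (map h (upTo (suc n))) ≈ sumL (map h (upTo n)) + h n
  sumL-map-upTo-suc h n =
    trans (reflexive (≡.cong (λ js → sumL (map h js)) (≡.sym (List.upTo-∷ʳ n))))
          (trans (sumL-map-++ h (upTo n) (n ∷ [])) (+-congˡ (+-identityʳ (h n))))

  sumL-map-upTo-≤ : ∀ (h : ℕ → Carrier) {v} n → (∀ j → j ℕ.< n → h j ≤ v) → sumL (map h (upTo n)) ≤ ι n * v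
  sumL-map-upTo-≤ h {v} zero    h≤v = ≤-reflexive (sym (zeroˡ v))
  sumL-map-upTo-≤ h {v} (suc n) h≤v =
    ≤-respˡ (sym (sumL-map-upTo-suc h n))
      (≤-respʳ (trans (+-comm _ v) (trans (+-congʳ (sym (*-identityˡ v))) (sym (distribʳ v 1# (ι n)))))
        (+-mono-≤ (sumL-map-upTo-≤ h n (λ j j<n → h≤v j (ℕ.m<n⇒m<1+n j<n))) (h≤v n (ℕ.n<1+n n))))

  min-≤ˡ : ∀ a b → min a b ≤ a
  min-≤ˡ a b with total a b
  ... | inj₁ _   = ≤-refl
  ... | inj₂ b≤a = b≤a

  min-≤ʳ : ∀ a b → min a b ≤ b
  min-≤ʳ a b with total a b
  ... | inj₁ a≤b = a≤b
  ... | inj₂ _   = ≤-refl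

  ≤-min : ∀ {v} a b → v ≤ a → v ≤ b → v ≤ min a b
  ≤-min a b v≤a v≤b with total a b
  ... | inj₁ _ = v≤a
  ... | inj₂ _ = v≤b

  minFin-≤ : ∀ n (g : Fin (suc n) → Carrier) t → minFin (suc n) g ≤ g t
  minFin-≤ zero    g Fin.zero    = ≤-refl
  minFin-≤ (suc n) g Fin.zero    = min-≤ˡ _ _
  minFin-≤ (suc n) g (Fin.suc t) = ≤-trans (min-≤ʳ _ _) (minFin-≤ n (λ i → g (Fin.suc i)) t)

  ≤-minFin : ∀ {v} n (g : Fin (suc n) → Carrier) → (∀ t → v ≤ g t) → v ≤ minFin (suc n) g
  ≤-minFin zero    g v≤g = v≤g Fin.zero
  ≤-minFin (suc n) g v≤g = ≤-min _ _ (v≤g Fin.zero) (≤-minFin n (λ i → g (Fin.suc i)) (λ t → v≤g (Fin.suc t)))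

  minFin-cong : ∀ n {g h : Fin n → Carrier} → (∀ t → g t ≡ h t) → minFin n g ≡ minFin n h
  minFin-cong zero          g≡h = ≡.refl
  minFin-cong (suc zero)    g≡h = g≡h Fin.zero
  minFin-cong (suc (suc n)) g≡h = ≡.cong₂ min (g≡h Fin.zero) (minFin-cong (suc n) (λ t → g≡h (Fin.suc t)))

  0≤D : ∀ p q → 0# ≤ D p q
  0≤D _ _ = ≤-respˡ (+-identityˡ 0#) (+-mono-≤ (0≤sq _) (0≤sq _))

  sq[x-x]≈0 : ∀ a → sq (a - a) ≈ 0#
  sq[x-x]≈0 a = trans (*-cong (-‿inverseʳ a) (-‿inverseʳ a)) (zeroˡ 0#)

  D-self : ∀ p → D p p ≈ 0#
  D-self (a , b) = trans (+-cong (sq[x-x]≈0 a) (sq[x-x]≈0 b)) (+-identityʳ 0#)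

  sumL-map-D-replicate : ∀ n p → sumL (map (λ q → D q p) (replicate n p)) ≈ 0#
  sumL-map-D-replicate n p = trans (sumL-map-replicate _ n p) (trans (*-congˡ (D-self p)) (zeroʳ (ι n)))

  D-vertical : ∀ x y → D (x , y) (x , 0#) ≈ sq y
  D-vertical x y = trans (+-cong (sq[x-x]≈0 x) (*-cong y-0≈y y-0≈y)) (+-identityˡ (sq y))
    where
    y-0≈y : y - 0# ≈ y
    y-0≈y = trans (+-congˡ -0#≈0#) (+-identityʳ y)

  sq≤D-origin : ∀ a b → sq a ≤ D (0# , 0#) (a , b)
  sq≤D-origin a b = ≤-respˡ (+-identityʳ (sq a))
    (+-mono-≤ (≤-reflexive (sym (trans (*-cong (+-identityˡ (- a)) (+-identityˡ (- a))) (sq-neg a))))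
              (0≤sq (0# - b)))

  module _ {k} (cs : Fin (suc k) → Point) where

    Φ-≤-single-center : ∀ t xs → Φ (suc k) cs xs ≤ sumL (map (λ p → D p (cs t)) xs)
    Φ-≤-single-center t = sumL-map-mono _ (λ p → minFin-≤ k (λ i → D p (cs i)) t)

    0≤Φ : ∀ xs → 0# ≤ Φ (suc k) cs xs
    0≤Φ = 0≤sumL-map _ (λ p → ≤-minFin k _ (λ t → 0≤D p (cs t)))

    Φ-replicate-≥ : ∀ {d} n p → (∀ t → d ≤ D p (cs t)) → ι n * d ≤ Φ (suc k) cs (replicate n p)
    Φ-replicate-≥ {d} n p d≤D = ≤-respʳ (sym (sumL-map-replicate _ n p))
      (≤-respˡ (*-comm d (ι n)) (≤-respʳ (*-comm _ (ι n))
        (*-monoˡ-≤-nonneg (ι n) (0≤ι n) (≤-minFin k _ d≤D))))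

  Φ-cong : ∀ k {cs cs' : Fin k → Point} → (∀ t → cs t ≡ cs' t) → ∀ xs → Φ k cs xs ≡ Φ k cs' xs
  Φ-cong k cs≡cs' xs = ≡.cong sumL (List.map-cong (λ p → minFin-cong k (λ t → ≡.cong (D p) (cs≡cs' t))) xs)

module InstanceX {c ℓ₁ ℓ₂ : Level} (F : OrderedField c ℓ₁ ℓ₂) where
  open OrderedField F renaming (_≤_ to infix 4 _≤_; _<_ to infix 4 _<_)
  open OrderedFieldProperties F
  open CommutativeRing commutativeRing
    using ( refl; sym; trans; reflexive; +-cong; +-congˡ; *-cong; *-congˡ; *-congʳ
          ; +-identityˡ; +-identityʳ; *-identityˡ; zeroʳ; *-assoc; distribˡ; distribʳ
          ; commutativeSemiring)
  open RingSolver commutativeSemiring using (solve; _:=_; _:*_)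

  Gᵢ-abscissa : ∀ k m r Δ i → All (λ p → proj₁ p ≡ xᵢ r Δ i) (Gᵢ k m r Δ i)
  Gᵢ-abscissa k m r Δ i = All.++⁺ (All.replicate⁺ (4 ℕ.* k ℕ.* mᵢ m i) ≡.refl)
    (All.concat⁺ (All.map⁺ (All.universal
      (λ j → All.++⁺ (All.replicate⁺ (mᵢ m i /4^ j) ≡.refl) (All.replicate⁺ (mᵢ m i /4^ j) ≡.refl))
      (upTo k))))

  module _ (n m : ℕ) {{m≢0 : NonZero m}}
           (4^∣m : ∀ i j → 1 ℕ.≤ i → i ℕ.≤ n → j ℕ.≤ n → 4 ^ ((i ∸ 1) ℕ.+ j) ∣ m)
           (r Δ : Carrier) (0<r : 0# < r) (1≤Δ : 1# ≤ Δ) where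

    k : ℕ
    k = suc n

    X : List Point
    X = instanceX k m r Δ

    N₀ : ℕ
    N₀ = 12 ℕ.* k ℕ.* 2 ^ k ℕ.* m

    Rest : List Point
    Rest = concatMap (λ l → Gᵢ k m r Δ (suc l)) (upTo n)

    4^l∣m : ∀ l → l ℕ.< n → 4 ^ l ∣ m
    4^l∣m l l<n = ≡.subst (λ e → 4 ^ e ∣ m) (ℕ.+-identityʳ l) (4^∣m (suc l) 0 (s≤s z≤n) l<n z≤n)

    0≤r : 0# ≤ r
    0≤r = proj₁ 0<r

    0<rᵢ : ∀ i → 0# < rᵢ r (suc i)
    0<rᵢ i = pos*pos⇒pos (0<ι (ℕ.m^n>0 2 i)) 0<r

    xᵢ-suc : ∀ i → xᵢ r Δ (suc i) ≈ xᵢ r Δ i + Δ * rᵢ r (suc i)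
    xᵢ-suc i = trans (*-congˡ (sumL-map-upTo-suc (λ l → rᵢ r (suc l)) i)) (distribˡ Δ _ _)

    xᵢ<xᵢ-suc : ∀ i → xᵢ r Δ i < xᵢ r Δ (suc i)
    xᵢ<xᵢ-suc i = <-respʳ (sym (xᵢ-suc i)) (x<x+y (pos*pos⇒pos (<-≤-trans 0<1 1≤Δ) (0<rᵢ i)))

    open StrictlyIncreasing (xᵢ r Δ) xᵢ<xᵢ-suc using (≈-injective; mono)

    r≤xᵢ : ∀ l → r ≤ xᵢ r Δ (suc l)
    r≤xᵢ l = ≤-trans (≤-respʳ (*-congˡ (sym x₁≈r)) (1≤y⇒x≤y*x 1≤Δ 0≤r)) (mono {1} {suc l} (s≤s z≤n))
      where
      x₁≈r : (1# + 0#) * r + 0# ≈ r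
      x₁≈r = trans (+-identityʳ _) (trans (*-congʳ (+-identityʳ 1#)) (*-identityˡ r))

    Rest-far : All (λ p → r ≤ proj₁ p) Rest
    Rest-far = All.concat⁺ (All.map⁺ (All.universal
      (λ l → All.map (λ x≡xₗ → ≤-respʳ (reflexive (≡.sym x≡xₗ)) (r≤xᵢ l)) (Gᵢ-abscissa k m r Δ (suc l)))
      (upTo n)))

    far-centers-cost : (cs : Fin k → Point) → (∀ t → r ≤ proj₁ (cs t)) → ι N₀ * sq r ≤ Φ k cs X
    far-centers-cost cs far = ≤-respʳ (sym (sumL-map-++ _ (G₀ k m) Rest))
      (≤-respˡ (+-identityʳ _) (+-mono-≤ (Φ-replicate-≥ cs N₀ (0# , 0#) r²≤D) (0≤Φ cs Rest)))
      where
      r²≤D : ∀ t → sq r ≤ D (0# , 0#) (cs t)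
      r²≤D t = ≤-trans (sq-mono-≤ 0≤r (far t)) (sq≤D-origin _ _)

    competitorCenter : Fin k → Point
    competitorCenter Fin.zero    = 0# , 0#
    competitorCenter (Fin.suc t) = xᵢ r Δ (suc (toℕ t)) , 0#

    competitorCenter-abscissa : ∀ t → proj₁ (competitorCenter t) ≈ xᵢ r Δ (toℕ t)
    competitorCenter-abscissa Fin.zero    = sym (zeroʳ Δ)
    competitorCenter-abscissa (Fin.suc t) = refl

    competitorCenter-injective : Injective _≡_ _≡_ competitorCenter
    competitorCenter-injective {s} {t} eq = Fin.toℕ-injective (≈-injective
      (trans (sym (competitorCenter-abscissa s))
        (trans (reflexive (≡.cong proj₁ eq)) (competitorCenter-abscissa t))))

    competitorCenter-∈ : ∀ t → competitorCenter t ∈ X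
    competitorCenter-∈ Fin.zero    = ∈-++⁺ˡ (∈-replicate⁺ N₀ {{N₀≢0}})
      where
      N₀≢0 : NonZero N₀
      N₀≢0 = ℕ.m*n≢0 (12 ℕ.* k ℕ.* 2 ^ k) m {{ℕ.m*n≢0 (12 ℕ.* k) (2 ^ k) {{_}} {{ℕ.m^n≢0 2 k}}}}
    competitorCenter-∈ (Fin.suc t) = ∈-++⁺ʳ (G₀ k m) (∈-concatMap⁺ (λ l → Gᵢ k m r Δ (suc l))
      (Any.map (λ { ≡.refl → ∈-++⁺ˡ (∈-replicate⁺ (4 ℕ.* k ℕ.* mᵢ m (suc l)) {{axisCount≢0}}) })
               (∈-upTo⁺ l<n)))
      where
      l : ℕ
      l = toℕ t
      l<n : l ℕ.< n
      l<n = Fin.toℕ<n t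
      mᵢ≢0 : NonZero (mᵢ m (suc l))
      mᵢ≢0 = ℕ.>-nonZero (ℕ.m≥n⇒m/n>0 {{ℕ.m^n≢0 4 l}} (∣⇒≤ (4^l∣m l l<n)))
      axisCount≢0 : NonZero (4 ℕ.* k ℕ.* mᵢ m (suc l))
      axisCount≢0 = ℕ.m*n≢0 (4 ℕ.* k) (mᵢ m (suc l)) {{_}} {{mᵢ≢0}}

    copies*height²≈m*r² : ∀ l j → l ℕ.< n → j ℕ.≤ n →
      ι (mᵢ m (suc l) /4^ j) * sq (ι (2 ^ j) * rᵢ r (suc l)) ≈ ι m * sq r
    copies*height²≈m*r² l j l<n j≤n = begin
      ι copies * sq (ι 2ʲ * (ι 2ˡ * r))                    ≈⟨ *-congˡ (regroup (ι 2ʲ) (ι 2ˡ) r) ⟩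
      ι copies * (((ι 2ʲ * ι 2ˡ) * (ι 2ʲ * ι 2ˡ)) * sq r)  ≈⟨ sym (*-assoc _ _ _) ⟩
      (ι copies * ((ι 2ʲ * ι 2ˡ) * (ι 2ʲ * ι 2ˡ))) * sq r  ≈⟨ *-congʳ (sym ι-count) ⟩
      ι (copies ℕ.* ((2ʲ ℕ.* 2ˡ) ℕ.* (2ʲ ℕ.* 2ˡ))) * sq r  ≈⟨ *-congʳ (reflexive (≡.cong ι count≡m)) ⟩
      ι m * sq r                                           ∎
      where
      open ≈-Reasoning setoid
      2ʲ 2ˡ copies : ℕ
      2ʲ = 2 ^ j
      2ˡ = 2 ^ l
      copies = mᵢ m (suc l) /4^ j
      regroup : ∀ x y z → sq (x * (y * z)) ≈ ((x * y) * (x * y)) * sq z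
      regroup = solve 3
        (λ x y z → (x :* (y :* z)) :* (x :* (y :* z)) := ((x :* y) :* (x :* y)) :* (z :* z)) refl
      ι-count : ι (copies ℕ.* ((2ʲ ℕ.* 2ˡ) ℕ.* (2ʲ ℕ.* 2ˡ))) ≈ ι copies * ((ι 2ʲ * ι 2ˡ) * (ι 2ʲ * ι 2ˡ))
      ι-count = trans (ι-* copies _)
        (*-congˡ (trans (ι-* (2ʲ ℕ.* 2ˡ) (2ʲ ℕ.* 2ˡ)) (*-cong (ι-* 2ʲ 2ˡ) (ι-* 2ʲ 2ˡ))))
      count≡m : copies ℕ.* ((2ʲ ℕ.* 2ˡ) ℕ.* (2ʲ ℕ.* 2ˡ)) ≡ m
      count≡m = ≡.trans (≡.cong (copies ℕ.*_) ([2^a*2^b]²≡4^b*4^a j l))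
        (m/a/b*[a*b]≡m m (4 ^ l) (4 ^ j) {{ℕ.m^n≢0 4 l}} {{ℕ.m^n≢0 4 j}}
          (≡.subst (_∣ m) (ℕ.^-distribˡ-+-* 4 l j) (4^∣m (suc l) j (s≤s z≤n) l<n j≤n)))

    groupCostBound : Carrier
    groupCostBound = ι k * (ι (m ℕ.+ m) * sq r)

    Gᵢ-vertical-cost : ∀ l → l ℕ.< n →
      sumL (map (λ p → D p (xᵢ r Δ (suc l) , 0#)) (Gᵢ k m r Δ (suc l))) ≤ groupCostBound
    Gᵢ-vertical-cost l l<n =
      ≤-respˡ (sym (sumL-map-++ cost (replicate axisCount (x , 0#)) (concatMap pair (upTo k))))
        (≤-respʳ (+-identityˡ _)
          (+-mono-≤ (≤-reflexive (sumL-map-D-replicate axisCount (x , 0#)))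
                    (≤-respˡ (sym (sumL-map-concatMap cost pair (upTo k)))
                      (sumL-map-upTo-≤ _ k (λ j j<k → ≤-reflexive (pair-cost j (ℕ.≤-pred j<k)))))))
      where
      x : Carrier
      x = xᵢ r Δ (suc l)
      axisCount : ℕ
      axisCount = 4 ℕ.* k ℕ.* mᵢ m (suc l)
      cost : Point → Carrier
      cost p = D p (x , 0#)
      pair : ℕ → List Point
      pair j = replicate (mᵢ m (suc l) /4^ j) (x , ι (2 ^ j) * rᵢ r (suc l))
            ++ replicate (mᵢ m (suc l) /4^ j) (x , - (ι (2 ^ j) * rᵢ r (suc l)))
      pair-cost : ∀ j → j ℕ.≤ n → sumL (map cost (pair j)) ≈ ι (m ℕ.+ m) * sq r
      pair-cost j j≤n = trans (sumL-map-++ cost (replicate copies (x , y)) (replicate copies (x , - y)))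
        (trans (+-cong (trans (sumL-map-replicate cost copies (x , y)) (*-congˡ (D-vertical x y)))
                       (trans (sumL-map-replicate cost copies (x , - y))
                              (*-congˡ (trans (D-vertical x (- y)) (sq-neg y)))))
        (trans (+-cong (copies*height²≈m*r² l j l<n j≤n) (copies*height²≈m*r² l j l<n j≤n))
        (sym (trans (*-congʳ (ι-+ m m)) (distribʳ (sq r) (ι m) (ι m))))))
        where
        copies : ℕ
        copies = mᵢ m (suc l) /4^ j
        y : Carrier
        y = ι (2 ^ j) * rᵢ r (suc l)

    competitorCenter-cost : Φ k competitorCenter X ≤ ι n * groupCostBound
    competitorCenter-cost = ≤-respˡ (sym (sumL-map-++ _ (G₀ k m) Rest))
      (≤-respʳ (+-identityˡ _) (+-mono-≤ G₀-cost Rest-cost))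
      where
      G₀-cost : Φ k competitorCenter (G₀ k m) ≤ 0#
      G₀-cost = ≤-trans (Φ-≤-single-center competitorCenter Fin.zero (G₀ k m))
        (≤-reflexive (sumL-map-D-replicate N₀ (0# , 0#)))
      Gᵢ-cost : ∀ l → l ℕ.< n → Φ k competitorCenter (Gᵢ k m r Δ (suc l)) ≤ groupCostBound
      Gᵢ-cost l l<n =
        ≤-trans (Φ-≤-single-center competitorCenter (Fin.suc (Fin.fromℕ< l<n)) (Gᵢ k m r Δ (suc l)))
        (≤-respˡ (reflexive (≡.cong (λ i → sumL (map (λ p → D p (xᵢ r Δ (suc i) , 0#)) (Gᵢ k m r Δ (suc l))))
                                    (≡.sym (Fin.toℕ-fromℕ< l<n))))
          (Gᵢ-vertical-cost l l<n))
      Rest-cost : Φ k competitorCenter Rest ≤ ι n * groupCostBound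
      Rest-cost = ≤-respˡ (sym (sumL-map-concatMap _ (λ l → Gᵢ k m r Δ (suc l)) (upTo n)))
        (sumL-map-upTo-≤ (λ l → Φ k competitorCenter (Gᵢ k m r Δ (suc l))) n Gᵢ-cost)

    competitor : Fin k → Fin (length X)
    competitor = indices competitorCenter-∈

    competitor-injective : Injective _≡_ _≡_ competitor
    competitor-injective = indices-injective competitorCenter-∈ competitorCenter-injective

    competitor-cost : Φ k (λ t → lookup X (competitor t)) X ≤ ι n * groupCostBound
    competitor-cost =
      ≤-respˡ (reflexive (≡.sym (Φ-cong k (lookup-indices competitorCenter-∈) X))) competitorCenter-cost

    cost-gap : ι n * groupCostBound < ι N₀ * sq r
    cost-gap = <-respˡ ι-assoc (ι-*-monoˡ-< (n*[k*[m+m]]<12*k*2^k*m n m) (pos*pos⇒pos 0<r 0<r))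
      where
      ι-assoc : ι (n ℕ.* (k ℕ.* (m ℕ.+ m))) * sq r ≈ ι n * groupCostBound
      ι-assoc = trans (*-congʳ (trans (ι-* n (k ℕ.* (m ℕ.+ m))) (*-congˡ (ι-* k (m ℕ.+ m)))))
                      (trans (*-assoc (ι n) _ (sq r)) (*-congˡ (*-assoc (ι k) (ι (m ℕ.+ m)) (sq r))))

    optimal-centers-contain-origin : (C : Fin k → Fin (length X)) →
      (∀ C' → Injective _≡_ _≡_ C' → Φ k (λ t → lookup X (C t)) X ≤ Φ k (λ t → lookup X (C' t)) X) →
      ∃ λ t → lookup X (C t) ≡ (0# , 0#)
    optimal-centers-contain-origin C C-optimal with ∃-⊎-∀ (λ t → ∈-++⁻ (G₀ k m) (∈-lookup (C t)))
    ... | inj₁ (t , C[t]∈G₀) = t , All.lookup (All.replicate⁺ {P = _≡ (0# , 0#)} N₀ ≡.refl) C[t]∈G₀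
    ... | inj₂ C[t]∈Rest     = ⊥-elim (<-irrefl (≤-<-trans
      (≤-trans (C-optimal competitor competitor-injective) competitor-cost)
      (<-≤-trans cost-gap (far-centers-cost _ (λ t → All.lookup Rest-far (C[t]∈Rest t))))))

lemma5 : ∀ {c ℓ₁ ℓ₂ : Level} (F : OrderedField c ℓ₁ ℓ₂) →
    let open OrderedField F in
    (k m : ℕ) → 2 ℕ.≤ k → NonZero m →
    (∀ i j → 1 ℕ.≤ i → i ℕ.≤ k ∸ 1 → j ℕ.≤ k ∸ 1 → 4 ^ ((i ∸ 1) ℕ.+ j) ∣ m) →
    (r Δ : Carrier) → 0# < r → 1# ≤ Δ →
    (C : Fin k → Fin (length (instanceX k m r Δ))) → Injective _≡_ _≡_ C →
    (∀ (C' : Fin k → Fin (length (instanceX k m r Δ))) → Injective _≡_ _≡_ C' →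
       Φ k (λ t → lookup (instanceX k m r Δ) (C t)) (instanceX k m r Δ)
         ≤ Φ k (λ t → lookup (instanceX k m r Δ) (C' t)) (instanceX k m r Δ)) →
    ∃ λ t → (proj₁ (lookup (instanceX k m r Δ) (C t)) ≈ 0#)
          × (proj₂ (lookup (instanceX k m r Δ) (C t)) ≈ 0#)
lemma5 F (suc (suc n)) m (s≤s (s≤s z≤n)) m≢0 4^∣m r Δ 0<r 1≤Δ C _ C-optimal =
  let t , C[t]≡origin = optimal-centers-contain-origin (suc n) m {{m≢0}} 4^∣m r Δ 0<r 1≤Δ C C-optimal
  in t , reflexive (≡.cong proj₁ C[t]≡origin) , reflexive (≡.cong proj₂ C[t]≡origin)
  where
  open InstanceX F using (optimal-centers-contain-origin)
  open Setoid (OrderedField.setoid F) using (reflexive)
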